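{- Let $n\ge1$ and $S\subseteq\{1,\dots,n\}$. Then $S$ is a join reducible element of the lattice $\mathcal{L}_n$ (i.e. there exist $Y,Z\in\mathcal{L}_n$ with $Y<_nS$, $Z<_nS$ and $S=Y\vee Z$) if and only if $S$ has a gap, i.e. there exists $1<k<n$ with $k\notin S$, $[1,k)\cap S\neq\emptyset$ and $(k,n]\cap S\neq\emptyset$.
   Context: Let $[k,n]=\{k,\dots,n\}$. $\mathcal{L}_n$ is the set of subsets of $\{1,\dots,n\}$ with $I\le_n J$ iff $\#(I\cap[k,n])\le\#(J\cap[k,n])$ for all $k=1,\dots,n$; it is a lattice, with join $\vee$. -}

module Defs where

open import Data.Nat using (ℕ; suc; _≤_; _<_; _≤ᵇ_)
open import Data.Fin using (Fin; toℕ)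
open import Data.Fin.Subset using (Subset; _∩_; ∣_∣; _∈_; _∉_)
open import Data.Vec using (tabulate)
open import Data.Product using (_×_; ∃-syntax)
open import Relation.Binary.PropositionalEquality using (_≡_)
open import Relation.Nullary using (¬_)

-- Convention: a subset of {1,…,n} is a  Subset n ; the element  i : Fin n
-- represents the integer  toℕ i + 1 .

interval : (n k : ℕ) → Subset n
interval n k = tabulate (λ (i : Fin n) → k ≤ᵇ suc (toℕ i))

tailCount : {n : ℕ} → Subset n → ℕ → ℕ
tailCount {n} I k = ∣ I ∩ interval n k ∣

_≤ₙ_ : {n : ℕ} → Subset n → Subset n → Set
_≤ₙ_ {n} I J = (k : ℕ) → 1 ≤ k → k ≤ n → tailCount I k ≤ tailCount J k

_<ₙ_ : {n : ℕ} → Subset n → Subset n → Set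
I <ₙ J = (I ≤ₙ J) × ¬ (I ≡ J)

IsJoin : {n : ℕ} → Subset n → Subset n → Subset n → Set
IsJoin {n} Y Z S =
  (Y ≤ₙ S) × (Z ≤ₙ S) × ((U : Subset n) → Y ≤ₙ U → Z ≤ₙ U → S ≤ₙ U)

JoinReducible : {n : ℕ} → Subset n → Set
JoinReducible {n} S = ∃[ Y ] ∃[ Z ] ((Y <ₙ S) × (Z <ₙ S) × IsJoin Y Z S)

HasGap : {n : ℕ} → Subset n → Set
HasGap {n} S =
  ∃[ k ] ((1 < suc (toℕ k)) × (suc (toℕ k) < n) × (k ∉ S)
         × (∃[ i ] ((toℕ i < toℕ k) × (i ∈ S)))
         × (∃[ j ] ((toℕ k < toℕ j) × (j ∈ S))))

module Submission where

-- Encode a subset I of {1,…,n} by its tail counts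
-- tail I m = #(I ∩ [m+1,n]); they determine I, and I ≤ₙ J says exactly that
-- every tail count of I is at most that of J.  Removing one element of S, or
-- moving an element of S to an empty position further left, lowers a range of
-- tail counts by one and leaves the others unchanged.
--
-- (⇐) If k is a gap with i ∈ S left of it and j ∈ S right of it, let Y be S
-- without i and Z be S with j moved to k.  Both lie strictly below S, and at
-- every position one of them has the same tail count as S, so S = Y ∨ Z.
--
-- (⇒) If S has no gap it is empty or an interval starting at its least
-- element a.  Then S is "rigid": an element V ≤ₙ S with the same tail count
-- at a equals S.  Hence every V <ₙ S lies below the element U obtained from
-- S by lowering only the tail count at a, while S itself does not; so S is
-- not the join of two strictly smaller elements.  Since having a gap is
-- decidable, this contrapositive yields the gap.

open import Defs
open import Data.Nat
open import Data.Nat.Properties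
open import Algebra.Properties.CommutativeSemigroup +-commutativeSemigroup using (x∙yz≈y∙xz)
open import Data.Bool using (Bool; true; false)
open import Data.Fin using (Fin; zero; suc; toℕ; fromℕ<; inject₁)
open import Data.Fin.Properties using (toℕ-fromℕ<; toℕ-injective; toℕ-inject₁; toℕ<n; any?)
open import Data.Fin.Subset using (Subset; _∉_; inside; outside)
open import Data.Fin.Subset.Properties using (_∈?_)
open import Data.Vec using ([]; _∷_; lookup; _[_]≔_)
open import Data.Vec.Properties using (lookup∘update; lookup∘update′; []=⇒lookup; lookup⇒[]=)
open import Data.Product using (_×_; _,_; ∃-syntax; Σ-syntax)
open import Data.Sum using (_⊎_; inj₁; inj₂)
open import Data.Empty using (⊥-elim)
open import Relation.Nullary using (¬_; Dec; yes; no)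
open import Relation.Nullary.Decidable using (_×-dec_; ¬?; decidable-stable)
open import Relation.Binary.PropositionalEquality
open import Relation.Binary.Definitions using (tri<; tri≈; tri>)
open import Function.Bundles using (_⇔_; mk⇔)

private
  variable
    n m : ℕ

bit : Bool → ℕ
bit true  = 1
bit false = 0

tail : Subset n → ℕ → ℕ
tail []      _       = 0
tail (x ∷ I) zero    = bit x + tail I zero
tail (_ ∷ I) (suc m) = tail I m

tailCount≡tail : (I : Subset n) (m : ℕ) → tailCount I (suc m) ≡ tail I m
tailCount≡tail []          m       = refl
tailCount≡tail (true ∷ I)  zero    = cong suc (tailCount≡tail I zero)
tailCount≡tail (false ∷ I) zero    = tailCount≡tail I zero
tailCount≡tail (true ∷ I)  (suc m) = tailCount≡tail I m
tailCount≡tail (false ∷ I) (suc m) = tailCount≡tail I m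

tail-beyond : (I : Subset n) → n ≤ m → tail I m ≡ 0
tail-beyond []      _         = refl
tail-beyond (_ ∷ I) (s≤s n≤m) = tail-beyond I n≤m

tail-step : (I : Subset n) (m<n : m < n) →
            tail I m ≡ bit (lookup I (fromℕ< m<n)) + tail I (suc m)
tail-step {m = zero}  (_ ∷ I) _         = refl
tail-step {m = suc m} (_ ∷ I) (s≤s m<n) = tail-step I m<n

tail-antitone : (I : Subset n) {m m′ : ℕ} → m ≤ m′ → tail I m′ ≤ tail I m
tail-antitone []      _                    = z≤n
tail-antitone (_ ∷ I) {zero} {zero}    _ = ≤-refl
tail-antitone (x ∷ I) {zero} {suc m′}  _ =
  ≤-trans (tail-antitone I {zero} {m′} z≤n) (m≤n+m (tail I zero) (bit x))
tail-antitone (_ ∷ I) (s≤s m≤m′)           = tail-antitone I m≤m′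

tail-witness : (I : Subset n) (m : ℕ) → 0 < tail I m →
               ∃[ r ] (m ≤ toℕ r × lookup I r ≡ true)
tail-witness (true ∷ I)  zero    _   = zero , z≤n , refl
tail-witness (false ∷ I) zero    pos with tail-witness I zero pos
... | r , _ , Ir = suc r , z≤n , Ir
tail-witness (_ ∷ I)     (suc m) pos with tail-witness I m pos
... | r , m≤r , Ir = suc r , s≤s m≤r , Ir

bit-injective : {x y : Bool} → bit x ≡ bit y → x ≡ y
bit-injective {true}  {true}  _ = refl
bit-injective {false} {false} _ = refl

tail-injective : (I J : Subset n) → (∀ m → tail I m ≡ tail J m) → I ≡ J
tail-injective []      []      _  = refl
tail-injective (x ∷ I) (y ∷ J) eq
  with refl ← tail-injective I J (λ m → eq (suc m)) =
  cong (_∷ J) (bit-injective (+-cancelʳ-≡ (tail J zero) (bit x) (bit y) (eq zero)))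

tail-update-above : (I : Subset n) (i : Fin n) (b : Bool) → toℕ i < m →
                    tail (I [ i ]≔ b) m ≡ tail I m
tail-update-above {m = suc m} (_ ∷ I) zero    b _         = refl
tail-update-above {m = suc m} (_ ∷ I) (suc i) b (s≤s i<m) = tail-update-above I i b i<m

tail-update-below : (I : Subset n) (i : Fin n) (b : Bool) → m ≤ toℕ i →
                    bit (lookup I i) + tail (I [ i ]≔ b) m ≡ bit b + tail I m
tail-update-below {m = zero}  (x ∷ I) zero    b _ = x∙yz≈y∙xz (bit x) (bit b) (tail I zero)
tail-update-below {m = zero}  (x ∷ I) (suc i) b _ = begin
  bit (lookup I i) + (bit x + tail (I [ i ]≔ b) zero) ≡⟨ x∙yz≈y∙xz (bit (lookup I i)) (bit x) _ ⟩
  bit x + (bit (lookup I i) + tail (I [ i ]≔ b) zero) ≡⟨ cong (bit x +_) (tail-update-below I i b z≤n) ⟩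
  bit x + (bit b + tail I zero)                       ≡⟨ x∙yz≈y∙xz (bit x) (bit b) (tail I zero) ⟩
  bit b + (bit x + tail I zero)                       ∎
  where open ≡-Reasoning
tail-update-below {m = suc m} (x ∷ I) (suc i) b (s≤s m≤i) = tail-update-below I i b m≤i

-- Comparison of tail counts at every position m ∈ ℕ; it is equivalent to
-- ≤ₙ (positions m ≥ n contribute nothing) but needs no range side conditions.
_≼_ : Subset n → Subset n → Set
I ≼ J = ∀ m → tail I m ≤ tail J m

≤ₙ⇒≼ : (I J : Subset n) → I ≤ₙ J → I ≼ J
≤ₙ⇒≼ {n} I J I≤J m with m <? n
... | yes m<n = subst₂ _≤_ (tailCount≡tail I m) (tailCount≡tail J m) (I≤J (suc m) (s≤s z≤n) m<n)
... | no  m≮n = subst (_≤ tail J m) (sym (tail-beyond I (≮⇒≥ m≮n))) z≤n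

≼⇒≤ₙ : (I J : Subset n) → I ≼ J → I ≤ₙ J
≼⇒≤ₙ I J I≼J (suc m) _ _ =
  subst₂ _≤_ (sym (tailCount≡tail I m)) (sym (tailCount≡tail J m)) (I≼J m)

∉⇒false : {I : Subset n} {p : Fin n} → p ∉ I → lookup I p ≡ false
∉⇒false {I = I} {p} p∉I with lookup I p in Ip
... | true  = ⊥-elim (p∉I (lookup⇒[]= p I Ip))
... | false = refl

remove insert : Subset n → Fin n → Subset n
remove I i = I [ i ]≔ outside
insert I k = I [ k ]≔ inside

tail-remove-≤ : {I : Subset n} {i : Fin n} → lookup I i ≡ true → m ≤ toℕ i →
                suc (tail (remove I i) m) ≡ tail I m
tail-remove-≤ {I = I} {i} Ii m≤i =
  subst (λ b → bit b + tail (remove I i) _ ≡ tail I _) Ii (tail-update-below I i outside m≤i)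

tail-insert-≤ : {I : Subset n} {k : Fin n} → lookup I k ≡ false → m ≤ toℕ k →
                tail (insert I k) m ≡ suc (tail I m)
tail-insert-≤ {I = I} {k} Ik m≤k =
  subst (λ b → bit b + tail (insert I k) _ ≡ suc (tail I _)) Ik (tail-update-below I k inside m≤k)

remove-≼ : {I : Subset n} {i : Fin n} → lookup I i ≡ true → remove I i ≼ I
remove-≼ {I = I} {i} Ii m with toℕ i <? m
... | yes i<m = ≤-reflexive (tail-update-above I i outside i<m)
... | no  i≮m = ≤-trans (n≤1+n _) (≤-reflexive (tail-remove-≤ {I = I} Ii (≮⇒≥ i≮m)))

move : Subset n → Fin n → Fin n → Subset n
move I j k = insert (remove I j) k

module _ {I : Subset n} {j k : Fin n} (Ij : lookup I j ≡ true) (Ik : lookup I k ≡ false)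
         (k<j : toℕ k < toℕ j) where

  private
    removed-k : lookup (remove I j) k ≡ false
    removed-k = trans (lookup∘update′ (λ k≡j → <-irrefl (cong toℕ k≡j) k<j) I outside) Ik

  tail-move-≤ : m ≤ toℕ k → tail (move I j k) m ≡ tail I m
  tail-move-≤ m≤k = trans (tail-insert-≤ {I = remove I j} removed-k m≤k)
                          (tail-remove-≤ {I = I} Ij (≤-trans m≤k (<⇒≤ k<j)))

  tail-move-between : toℕ k < m → m ≤ toℕ j → suc (tail (move I j k) m) ≡ tail I m
  tail-move-between k<m m≤j =
    trans (cong suc (tail-update-above (remove I j) k inside k<m)) (tail-remove-≤ {I = I} Ij m≤j)

  tail-move-> : toℕ j < m → tail (move I j k) m ≡ tail I m
  tail-move-> j<m =
    trans (tail-update-above (remove I j) k inside (<-trans k<j j<m))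
          (tail-update-above I j outside j<m)

  move-≼ : move I j k ≼ I
  move-≼ m with m ≤? toℕ k | m ≤? toℕ j
  ... | yes m≤k | _       = ≤-reflexive (tail-move-≤ m≤k)
  ... | no  m≰k | yes m≤j = ≤-trans (n≤1+n _) (≤-reflexive (tail-move-between (≰⇒> m≰k) m≤j))
  ... | no  _   | no  m≰j = ≤-reflexive (tail-move-> (≰⇒> m≰j))

join-by-cover : {Y Z S : Subset n} → Y ≼ S → Z ≼ S →
                (∀ m → tail Y m ≡ tail S m ⊎ tail Z m ≡ tail S m) → IsJoin Y Z S
join-by-cover {Y = Y} {Z} {S} Y≼S Z≼S cover = ≼⇒≤ₙ Y S Y≼S , ≼⇒≤ₙ Z S Z≼S , least
  where
    least : ∀ U → Y ≤ₙ U → Z ≤ₙ U → S ≤ₙ U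
    least U Y≤U Z≤U = ≼⇒≤ₙ S U λ m → case m (cover m)
      where
        case : ∀ m → tail Y m ≡ tail S m ⊎ tail Z m ≡ tail S m → tail S m ≤ tail U m
        case m (inj₁ Ym≡Sm) = subst (_≤ tail U m) Ym≡Sm (≤ₙ⇒≼ Y U Y≤U m)
        case m (inj₂ Zm≡Sm) = subst (_≤ tail U m) Zm≡Sm (≤ₙ⇒≼ Z U Z≤U m)

gap⇒reducible : (S : Subset n) → HasGap S → JoinReducible S
gap⇒reducible {n} S (k , _ , _ , k∉S , (i , i<k , i∈S) , (j , k<j , j∈S)) =
  Y , Z , (≼⇒≤ₙ Y S Y≼S , Y≢S) , (≼⇒≤ₙ Z S Z≼S , Z≢S) ,
  join-by-cover {Y = Y} {Z} {S} Y≼S Z≼S cover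
  where
    Si : lookup S i ≡ true
    Si = []=⇒lookup i∈S
    Sk : lookup S k ≡ false
    Sk = ∉⇒false k∉S
    Y Z : Subset n
    Y = remove S i
    Z = move S j k
    Y≼S : Y ≼ S
    Y≼S = remove-≼ {I = S} Si
    Z≼S : Z ≼ S
    Z≼S = move-≼ {I = S} ([]=⇒lookup j∈S) Sk k<j
    Y≢S : ¬ Y ≡ S
    Y≢S Y≡S with () ← trans (sym (lookup∘update i S outside))
                            (trans (cong (λ V → lookup V i) Y≡S) Si)
    Z≢S : ¬ Z ≡ S
    Z≢S Z≡S with () ← trans (sym (lookup∘update k (remove S j) inside))
                            (trans (cong (λ V → lookup V k) Z≡S) Sk)
    -- Y agrees with S beyond i, and Z agrees with S up to k > i.
    cover : ∀ m → tail Y m ≡ tail S m ⊎ tail Z m ≡ tail S m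
    cover m with toℕ i <? m
    ... | yes i<m = inj₁ (tail-update-above S i outside i<m)
    ... | no  i≮m =
      inj₂ (tail-move-≤ {I = S} ([]=⇒lookup j∈S) Sk k<j (≤-trans (≮⇒≥ i≮m) (<⇒≤ i<k)))

Convex : Subset n → Set
Convex S = ∀ {p q r} → toℕ p < toℕ q → toℕ q < toℕ r →
           lookup S p ≡ true → lookup S r ≡ true → lookup S q ≡ true

gapless⇒convex : (S : Subset n) → ¬ HasGap S → Convex S
gapless⇒convex S noGap {p} {q} {r} p<q q<r Sp Sr with lookup S q in Sq
... | true  = refl
... | false = ⊥-elim (noGap (q , s≤s (≤-trans (s≤s z≤n) p<q) , ≤-trans (s≤s q<r) (toℕ<n r) ,
                             q∉S , (p , p<q , lookup⇒[]= p S Sp) , (r , q<r , lookup⇒[]= r S Sr)))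
  where
    q∉S : q ∉ S
    q∉S q∈S with () ← trans (sym Sq) ([]=⇒lookup q∈S)

hasGap? : (S : Subset n) → Dec (HasGap S)
hasGap? {n} S = any? λ k →
  (1 <? suc (toℕ k)) ×-dec (suc (toℕ k) <? n) ×-dec ¬? (k ∈? S) ×-dec
  any? (λ i → (toℕ i <? toℕ k) ×-dec (i ∈? S)) ×-dec
  any? (λ j → (toℕ k <? toℕ j) ×-dec (j ∈? S))

IsLeast : Subset n → Fin n → Set
IsLeast S a = lookup S a ≡ true × (∀ p → toℕ p < toℕ a → lookup S p ≡ false)

least-element : (S : Subset n) → (∀ p → lookup S p ≡ false) ⊎ ∃[ a ] IsLeast S a
least-element []          = inj₁ λ ()
least-element (true ∷ S)  = inj₂ (zero , refl , λ _ ())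
least-element (false ∷ S) with least-element S
... | inj₁ empty           = inj₁ λ { zero → refl ; (suc p) → empty p }
... | inj₂ (a , Sa , below) =
  inj₂ (suc a , Sa , λ { zero _ → refl ; (suc p) (s≤s p<a) → below p p<a })

empty-minimal : (S V : Subset n) → (∀ p → lookup S p ≡ false) → V ≼ S → V ≡ S
empty-minimal S V empty V≼S = tail-injective V S λ m →
  trans (n≤0⇒n≡0 (subst (tail V m ≤_) (S-vanishes m) (V≼S m))) (sym (S-vanishes m))
  where
    S-vanishes : ∀ m → tail S m ≡ 0
    S-vanishes m with tail S m in Sm
    ... | zero  = refl
    ... | suc _ with r , _ , Sr ← tail-witness S m (subst (0 <_) (sym Sm) z<s)
                with () ← trans (sym Sr) (empty r)

tail-before-least : (S : Subset n) (a : Fin n) →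
                    (∀ p → toℕ p < toℕ a → lookup S p ≡ false) →
                    m ≤ toℕ a → tail S m ≡ tail S (toℕ a)
tail-before-least (_ ∷ S) zero    _     z≤n = refl
tail-before-least (x ∷ S) (suc a) below z≤n rewrite below zero z<s =
  tail-before-least S a (λ p p<a → below (suc p) (s≤s p<a)) z≤n
tail-before-least (_ ∷ S) (suc a) below (s≤s m≤a) =
  tail-before-least S a (λ p p<a → below (suc p) (s≤s p<a)) m≤a

convex-ends : (S : Subset n) {a p : Fin n} → Convex S → lookup S a ≡ true →
              lookup S p ≡ false → toℕ a ≤ toℕ p → tail S (suc (toℕ p)) ≡ 0
convex-ends S {a} {p} convex Sa Sp a≤p with tail S (suc (toℕ p)) in Sp+1
... | zero  = refl
... | suc _ with r , p<r , Sr ← tail-witness S (suc (toℕ p)) (subst (0 <_) (sym Sp+1) z<s)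
            with toℕ a <? toℕ p
...   | yes a<p with () ← trans (sym (convex a<p p<r Sa Sr)) Sp
...   | no  a≮p with refl ← toℕ-injective {i = a} {p} (≤-antisym a≤p (≮⇒≥ a≮p))
                with () ← trans (sym Sa) Sp

bit≤1 : (b : Bool) → bit b ≤ 1
bit≤1 true  = s≤s z≤n
bit≤1 false = z≤n

-- For V ≼ S with S convex, agreement of tail counts at a position m ≥ a
-- (a ∈ S) propagates to m + 1: inside S both drop by one, after S both vanish.
rigid-step : (S V : Subset n) {a : Fin n} → Convex S → lookup S a ≡ true → V ≼ S →
             toℕ a ≤ m → tail V m ≡ tail S m → tail V (suc m) ≡ tail S (suc m)
rigid-step {n} {m} S V convex Sa V≼S a≤m Vm≡Sm with m <? n
... | no  m≮n = trans (tail-beyond V (≤-trans (≮⇒≥ m≮n) (n≤1+n m)))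
                      (sym (tail-beyond S (≤-trans (≮⇒≥ m≮n) (n≤1+n m))))
... | yes m<n with lookup S (fromℕ< m<n) in Sm
...   | true  = ≤-antisym (V≼S (suc m)) (s≤s⁻¹ (begin
  suc (tail S (suc m))                         ≡⟨ cong (λ b → bit b + tail S (suc m)) Sm ⟨
  bit (lookup S (fromℕ< m<n)) + tail S (suc m) ≡⟨ tail-step S m<n ⟨
  tail S m                                     ≡⟨ Vm≡Sm ⟨
  tail V m                                     ≡⟨ tail-step V m<n ⟩
  bit (lookup V (fromℕ< m<n)) + tail V (suc m) ≤⟨ +-monoˡ-≤ (tail V (suc m)) (bit≤1 _) ⟩
  suc (tail V (suc m))                         ∎))
  where open ≤-Reasoning
...   | false = trans (n≤0⇒n≡0 (subst (tail V (suc m) ≤_) S-ends (V≼S (suc m)))) (sym S-ends)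
  where
    S-ends : tail S (suc m) ≡ 0
    S-ends = subst (λ q → tail S (suc q) ≡ 0) (toℕ-fromℕ< m<n)
               (convex-ends S convex Sa Sm (subst (toℕ _ ≤_) (sym (toℕ-fromℕ< m<n)) a≤m))

rigid : (S V : Subset n) {a : Fin n} → Convex S → IsLeast S a → V ≼ S →
        tail S (toℕ a) ≤ tail V (toℕ a) → V ≡ S
rigid S V {a} convex (Sa , below) V≼S Sa≤Va = tail-injective V S agree
  where
    up-to-a : ∀ {m} → m ≤ toℕ a → tail V m ≡ tail S m
    up-to-a {m} m≤a = ≤-antisym (V≼S m) (begin
      tail S m       ≡⟨ tail-before-least S a below m≤a ⟩
      tail S (toℕ a) ≤⟨ Sa≤Va ⟩
      tail V (toℕ a) ≤⟨ tail-antitone V m≤a ⟩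
      tail V m       ∎)
      where open ≤-Reasoning
    agree : ∀ m → tail V m ≡ tail S m
    agree zero    = up-to-a z≤n
    agree (suc m) with suc m ≤? toℕ a
    ... | yes m<a = up-to-a m<a
    ... | no  m≮a = rigid-step S V convex Sa V≼S (s≤s⁻¹ (≰⇒> m≮a)) (agree m)

-- Lowering S at its least element a: U has the tail counts of S except at
-- a, where it has one less (drop a, or move it one step to the left).
dent : (S : Subset n) (a : Fin n) → IsLeast S a →
       Σ[ U ∈ Subset n ] ((∀ m → m ≢ toℕ a → tail U m ≡ tail S m) ×
                          suc (tail U (toℕ a)) ≡ tail S (toℕ a))
dent S zero (Sa , _) = remove S zero , agree , tail-remove-≤ {I = S} Sa z≤n
  where
    agree : ∀ m → m ≢ 0 → tail (remove S zero) m ≡ tail S m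
    agree zero    m≢0 = ⊥-elim (m≢0 refl)
    agree (suc m) _   = tail-update-above S zero outside z<s
dent S (suc a) (Sa , below) =
  move S (suc a) (inject₁ a) , agree , tail-move-between {I = S} Sa Sk k<a+1 k<a+1 ≤-refl
  where
    k<a+1 : toℕ (inject₁ a) < suc (toℕ a)
    k<a+1 = s≤s (≤-reflexive (toℕ-inject₁ a))
    Sk : lookup S (inject₁ a) ≡ false
    Sk = below (inject₁ a) k<a+1
    agree : ∀ m → m ≢ suc (toℕ a) → tail (move S (suc a) (inject₁ a)) m ≡ tail S m
    agree m m≢a+1 with <-cmp m (suc (toℕ a))
    ... | tri< m<a+1 _ _ =
      tail-move-≤ {I = S} Sa Sk k<a+1 (subst (m ≤_) (sym (toℕ-inject₁ a)) (s≤s⁻¹ m<a+1))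
    ... | tri≈ _ m≡a+1 _ = ⊥-elim (m≢a+1 m≡a+1)
    ... | tri> _ _ a+1<m = tail-move-> {I = S} Sa Sk k<a+1 a+1<m

-- (⇒) A convex S is join irreducible: every V <ₙ S lies below the dent U
-- of S, but S does not.
convex⇒irreducible : (S : Subset n) → Convex S → ¬ JoinReducible S
convex⇒irreducible {n} S convex (Y , Z , (Y≤S , Y≢S) , (Z≤S , Z≢S) , _ , _ , least-upper)
  with least-element S
... | inj₁ empty = Y≢S (empty-minimal S Y empty (≤ₙ⇒≼ Y S Y≤S))
... | inj₂ (a , least) with U , agree , drop ← dent S a least =
  <-irrefl refl (subst (_≤ tail U (toℕ a)) (sym drop) (S≼U (toℕ a)))
  where
    below-dent : (V : Subset n) → V ≤ₙ S → V ≢ S → V ≼ U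
    below-dent V V≤S V≢S m with m ≟ toℕ a
    ... | no  m≢a  = subst (tail V m ≤_) (sym (agree m m≢a)) (≤ₙ⇒≼ V S V≤S m)
    ... | yes refl = s≤s⁻¹ (subst (suc (tail V m) ≤_) (sym drop) Va<Sa)
      where
        Va<Sa : tail V m < tail S m
        Va<Sa = ≰⇒> λ Sa≤Va → V≢S (rigid S V convex least (≤ₙ⇒≼ V S V≤S) Sa≤Va)
    S≼U : S ≼ U
    S≼U = ≤ₙ⇒≼ S U (least-upper U (≼⇒≤ₙ Y U (below-dent Y Y≤S Y≢S))
                                  (≼⇒≤ₙ Z U (below-dent Z Z≤S Z≢S)))

reducible⇒gap : (S : Subset n) → JoinReducible S → HasGap S
reducible⇒gap S reducible =
  decidable-stable (hasGap? S) λ noGap → convex⇒irreducible S (gapless⇒convex S noGap) reducible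

proposition3p21 : (n : ℕ) → 1 ≤ n → (S : Subset n) → JoinReducible S ⇔ HasGap S
proposition3p21 _ _ S = mk⇔ (reducible⇒gap S) (gap⇒reducible S)
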